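{- An algebra $(A,\rightarrow,\rightsquigarrow,1)$ of type $(2,2,0)$ is a commutative pseudo-BE algebra if and only if it satisfies, for all $x,y,z\in A$: $(P_1)$ $1\rightarrow x=1\rightsquigarrow x=x$; $(P_2)$ $x\rightarrow 1=x\rightsquigarrow 1=1$; $(P_3)$ $(x\rightarrow z)\rightsquigarrow(y\rightarrow z)=(z\rightarrow x)\rightsquigarrow(y\rightarrow x)$ and $(x\rightsquigarrow z)\rightarrow(y\rightsquigarrow z)=(z\rightsquigarrow x)\rightarrow(y\rightsquigarrow x)$; $(P_4)$ $x\rightarrow(y\rightsquigarrow z)=y\rightsquigarrow(x\rightarrow z)$; $(P_5)$ $x\rightarrow y=1$ iff $x\rightsquigarrow y=1$.
   Context: A pseudo-BE algebra is an algebra $(A,\rightarrow,\rightsquigarrow,1)$ of type $(2,2,0)$ such that for all $x,y,z\in A$: $x\rightarrow x=x\rightsquigarrow x=1$; $x\rightarrow 1=x\rightsquigarrow 1=1$; $1\rightarrow x=1\rightsquigarrow x=x$; $x\rightarrow(y\rightsquigarrow z)=y\rightsquigarrow(x\rightarrow z)$; $x\rightarrow y=1$ iff $x\rightsquigarrow y=1$. It is commutative if $(x\rightarrow y)\rightsquigarrow y=(y\rightarrow x)\rightsquigarrow x$ and $(x\rightsquigarrow y)\rightarrow y=(y\rightsquigarrow x)\rightarrow x$ for all $x,y\in A$. -}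

module Defs where

open import Level using (Level; suc; _⊔_)
open import Relation.Binary.PropositionalEquality using (_≡_)
open import Data.Product using (_×_)
open import Function.Bundles using (_⇔_)

record Algebra220 (a : Level) : Set (suc a) where
  field
    Carrier : Set a
    _⟶_     : Carrier → Carrier → Carrier
    _⇝_     : Carrier → Carrier → Carrier
    𝟏       : Carrier

module _ {a : Level} (𝔸 : Algebra220 a) where
  open Algebra220 𝔸

  record IsPseudoBE : Set a where
    field
      refl⟶   : ∀ x → x ⟶ x ≡ 𝟏
      refl⇝   : ∀ x → x ⇝ x ≡ 𝟏
      top⟶    : ∀ x → x ⟶ 𝟏 ≡ 𝟏
      top⇝    : ∀ x → x ⇝ 𝟏 ≡ 𝟏
      left⟶   : ∀ x → 𝟏 ⟶ x ≡ x
      left⇝   : ∀ x → 𝟏 ⇝ x ≡ x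
      exch    : ∀ x y z → x ⟶ (y ⇝ z) ≡ y ⇝ (x ⟶ z)
      iff1    : ∀ x y → (x ⟶ y ≡ 𝟏) ⇔ (x ⇝ y ≡ 𝟏)

  IsCommutative : Set a
  IsCommutative =
    (∀ x y → (x ⟶ y) ⇝ y ≡ (y ⟶ x) ⇝ x) ×
    (∀ x y → (x ⇝ y) ⟶ y ≡ (y ⇝ x) ⟶ x)

  IsCommutativePseudoBE : Set a
  IsCommutativePseudoBE = IsPseudoBE × IsCommutative

  record SatisfiesP : Set a where
    field
      P1⟶ : ∀ x → 𝟏 ⟶ x ≡ x
      P1⇝ : ∀ x → 𝟏 ⇝ x ≡ x
      P2⟶ : ∀ x → x ⟶ 𝟏 ≡ 𝟏
      P2⇝ : ∀ x → x ⇝ 𝟏 ≡ 𝟏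
      P3a : ∀ x y z → (x ⟶ z) ⇝ (y ⟶ z) ≡ (z ⟶ x) ⇝ (y ⟶ x)
      P3b : ∀ x y z → (x ⇝ z) ⟶ (y ⇝ z) ≡ (z ⇝ x) ⟶ (y ⇝ x)
      P4  : ∀ x y z → x ⟶ (y ⇝ z) ≡ y ⇝ (x ⟶ z)
      P5  : ∀ x y → (x ⟶ y ≡ 𝟏) ⇔ (x ⇝ y ≡ 𝟏)

module Submission where

-- Both axiom systems contain the unit laws (P1), (P2), the
-- exchange law (P4) and the equivalence (P5); they differ only in that a
-- commutative pseudo-BE algebra has the reflexivity laws x → x = x ⇝ x = 1
-- together with commutativity, where the P-system has (P3) instead.
--
--  * (⇒) By exchange, (x → z) ⇝ (y → z) = y → ((x → z) ⇝ z): both sides of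
--    (P3a) are y applied to the two sides of a commutativity law, so
--    commutativity yields (P3a); (P3b) is dual.
--  * (⇐) Instantiating (P3) at y = 1 and simplifying with (P1) gives back
--    commutativity.  Instantiating (P3a) at x = y = 1 and simplifying with
--    (P1), (P2) gives x ⇝ x = 1, and (P5) turns this into x → x = 1.

open import Defs
open import Level using (Level)
open import Function.Bundles using (_⇔_; mk⇔; Equivalence)
open import Data.Product using (_,_)
open import Relation.Binary.PropositionalEquality
  using (_≡_; sym; cong; cong₂; module ≡-Reasoning)

module _ {a : Level} (𝔸 : Algebra220 a) where
  open Algebra220 𝔸

  module PseudoBEFacts (be : IsPseudoBE 𝔸) where
    open IsPseudoBE be
    open ≡-Reasoning

    ⇝-of-⟶-suffix : ∀ x y z → (x ⟶ z) ⇝ (y ⟶ z) ≡ y ⟶ ((x ⟶ z) ⇝ z)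
    ⇝-of-⟶-suffix x y z = sym (exch y (x ⟶ z) z)

    ⟶-of-⇝-suffix : ∀ x y z → (x ⇝ z) ⟶ (y ⇝ z) ≡ y ⇝ ((x ⇝ z) ⟶ z)
    ⟶-of-⇝-suffix x y z = exch (x ⇝ z) y z

    commutative⇒P3a : (∀ x y → (x ⟶ y) ⇝ y ≡ (y ⟶ x) ⇝ x) →
                      ∀ x y z → (x ⟶ z) ⇝ (y ⟶ z) ≡ (z ⟶ x) ⇝ (y ⟶ x)
    commutative⇒P3a comm x y z = begin
      (x ⟶ z) ⇝ (y ⟶ z)    ≡⟨ ⇝-of-⟶-suffix x y z ⟩
      y ⟶ ((x ⟶ z) ⇝ z)    ≡⟨ cong (y ⟶_) (comm x z) ⟩
      y ⟶ ((z ⟶ x) ⇝ x)    ≡⟨ sym (⇝-of-⟶-suffix z y x) ⟩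
      (z ⟶ x) ⇝ (y ⟶ x)    ∎

    commutative⇒P3b : (∀ x y → (x ⇝ y) ⟶ y ≡ (y ⇝ x) ⟶ x) →
                      ∀ x y z → (x ⇝ z) ⟶ (y ⇝ z) ≡ (z ⇝ x) ⟶ (y ⇝ x)
    commutative⇒P3b comm x y z = begin
      (x ⇝ z) ⟶ (y ⇝ z)    ≡⟨ ⟶-of-⇝-suffix x y z ⟩
      y ⇝ ((x ⇝ z) ⟶ z)    ≡⟨ cong (y ⇝_) (comm x z) ⟩
      y ⇝ ((z ⇝ x) ⟶ x)    ≡⟨ sym (⟶-of-⇝-suffix z y x) ⟩
      (z ⇝ x) ⟶ (y ⇝ x)    ∎

  module PFacts (p : SatisfiesP 𝔸) where
    open SatisfiesP p
    open ≡-Reasoning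

    P3a⇒commutative : ∀ x y → (x ⟶ y) ⇝ y ≡ (y ⟶ x) ⇝ x
    P3a⇒commutative x y = begin
      (x ⟶ y) ⇝ y          ≡⟨ cong ((x ⟶ y) ⇝_) (sym (P1⟶ y)) ⟩
      (x ⟶ y) ⇝ (𝟏 ⟶ y)    ≡⟨ P3a x 𝟏 y ⟩
      (y ⟶ x) ⇝ (𝟏 ⟶ x)    ≡⟨ cong ((y ⟶ x) ⇝_) (P1⟶ x) ⟩
      (y ⟶ x) ⇝ x          ∎

    P3b⇒commutative : ∀ x y → (x ⇝ y) ⟶ y ≡ (y ⇝ x) ⟶ x
    P3b⇒commutative x y = begin
      (x ⇝ y) ⟶ y          ≡⟨ cong ((x ⇝ y) ⟶_) (sym (P1⇝ y)) ⟩
      (x ⇝ y) ⟶ (𝟏 ⇝ y)    ≡⟨ P3b x 𝟏 y ⟩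
      (y ⇝ x) ⟶ (𝟏 ⇝ x)    ≡⟨ cong ((y ⇝ x) ⟶_) (P1⇝ x) ⟩
      (y ⇝ x) ⟶ x          ∎

    refl⇝ : ∀ x → x ⇝ x ≡ 𝟏
    refl⇝ x = begin
      x ⇝ x                ≡⟨ cong₂ _⇝_ (sym (P1⟶ x)) (sym (P1⟶ x)) ⟩
      (𝟏 ⟶ x) ⇝ (𝟏 ⟶ x)    ≡⟨ P3a 𝟏 𝟏 x ⟩
      (x ⟶ 𝟏) ⇝ (𝟏 ⟶ 𝟏)    ≡⟨ cong₂ _⇝_ (P2⟶ x) (P2⟶ 𝟏) ⟩
      𝟏 ⇝ 𝟏                ≡⟨ P2⇝ 𝟏 ⟩
      𝟏                    ∎

    refl⟶ : ∀ x → x ⟶ x ≡ 𝟏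
    refl⟶ x = Equivalence.from (P5 x x) (refl⇝ x)

  commutativePseudoBE⇒P : IsCommutativePseudoBE 𝔸 → SatisfiesP 𝔸
  commutativePseudoBE⇒P (be , comm⟶⇝ , comm⇝⟶) = record
    { P1⟶ = left⟶ ; P1⇝ = left⇝ ; P2⟶ = top⟶ ; P2⇝ = top⇝
    ; P3a = commutative⇒P3a comm⟶⇝ ; P3b = commutative⇒P3b comm⇝⟶
    ; P4 = exch ; P5 = iff1 }
    where open IsPseudoBE be
          open PseudoBEFacts be

  P⇒commutativePseudoBE : SatisfiesP 𝔸 → IsCommutativePseudoBE 𝔸
  P⇒commutativePseudoBE p =
    record { refl⟶ = refl⟶ ; refl⇝ = refl⇝ ; top⟶ = P2⟶ ; top⇝ = P2⇝
           ; left⟶ = P1⟶ ; left⇝ = P1⇝ ; exch = P4 ; iff1 = P5 }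
    , P3a⇒commutative , P3b⇒commutative
    where open SatisfiesP p
          open PFacts p

theorem4p13 : {a : Level} (𝔸 : Algebra220 a) →
    IsCommutativePseudoBE 𝔸 ⇔ SatisfiesP 𝔸
theorem4p13 𝔸 = mk⇔ (commutativePseudoBE⇒P 𝔸) (P⇒commutativePseudoBE 𝔸)
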